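{- If $m \in \{8,40,42,50,74,76,80,86,100,130,144,150\}$, then there is no self-orthogonal $7$-$(24m,4m+4,\lambda_7)$ design, where $$\lambda_7 = \binom{5m-2}{m-1}\frac{(4m-1)(4m-2)}{(24m-5)(24m-6)}.$$
   Context: A $t$-$(v,k,\lambda)$ design is a pair $(X,\mathcal{B})$ where $|X|=v$ and $\mathcal{B}$ is a collection of $k$-subsets of $X$ (blocks) such that every $t$-subset of $X$ is contained in exactly $\lambda$ blocks. A $t$-$(v,k,\lambda)$ design is self-orthogonal if the intersection of any two blocks has the same parity as the block size $k$. -}

module Defs where

open import Data.Nat using (ℕ; _*_; _∸_; _+_; _%_)
open import Data.Nat.Combinatorics using (_C_)
open import Data.List using (List; length; filter; _∷_; [])
open import Data.List.Membership.Propositional using (_∈_)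
open import Data.Fin.Subset using (Subset; ∣_∣; _⊆_; _∩_)
open import Data.Fin.Subset.Properties using (_⊆?_)
open import Data.Product using (_×_)
open import Relation.Binary.PropositionalEquality using (_≡_)

-- A design on point set X = Fin v: a finite multiset (list) of blocks,
-- each block a subset of Fin v.
-- Number of blocks (with multiplicity) containing the subset T.
blocksContaining : ∀ {v} → Subset v → List (Subset v) → ℕ
blocksContaining T ℬ = length (filter (λ B → T ⊆? B) ℬ)

IsDesign : (t v k λ′ : ℕ) → List (Subset v) → Set
IsDesign t v k λ′ ℬ =
  (∀ B → B ∈ ℬ → ∣ B ∣ ≡ k) ×
  (∀ (T : Subset v) → ∣ T ∣ ≡ t → blocksContaining T ℬ ≡ λ′)

SelfOrthogonal : ∀ {v} → ℕ → List (Subset v) → Set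
SelfOrthogonal k ℬ = ∀ B B′ → B ∈ ℬ → B′ ∈ ℬ → ∣ B ∩ B′ ∣ % 2 ≡ k % 2

exceptionalMs : List ℕ
exceptionalMs = 8 ∷ 40 ∷ 42 ∷ 50 ∷ 74 ∷ 76 ∷ 80 ∷ 86 ∷ 100 ∷ 130 ∷ 144 ∷ 150 ∷ []

IsLambda7 : ℕ → ℕ → Set
IsLambda7 m λ₇ =
  λ₇ * ((24 * m ∸ 5) * (24 * m ∸ 6)) ≡ ((5 * m ∸ 2) C (m ∸ 1)) * ((4 * m ∸ 1) * (4 * m ∸ 2))

module Submission where

-- Fix a block B of a self-orthogonal t-(v,k,λ) design. Counting in two ways the pairs (B′, T) of
-- a block B′ and a t-subset T ⊆ B′ meeting B in exactly s points gives, for every s ≤ t,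
--   Σ_{B′} C(|B′ ∩ B|, s) C(k − |B′ ∩ B|, t − s) = λ C(k, s) C(v − k, t − s),
-- while self-orthogonality gives every |B′ ∩ B| the parity of k. Hence, for any modulus N and
-- weights c_s with Σ_s c_s C(i, s) C(k − i, t − s) ≡ 0 (mod N) whenever i ≤ k has the parity of
-- k, N divides λ Σ_s c_s C(k, s) C(v − k, t − s). For t = 7, v = 24m, k = 4m + 4 and each
-- exceptional m, explicit N and weights (residues modulo N) violate this.

open import Defs
open import Algebra.Properties.CommutativeSemigroup
  using (interchange; x∙yz≈y∙xz)
open import Data.Bool using (Bool; true; false; _∧_)
open import Data.Bool.Properties using (∧-zeroʳ; T-∧; T-≡)
open import Data.Fin using (toℕ)
open import Data.Fin.Properties using (toℕ<n)
open import Data.Fin.Subset using (Subset; ∣_∣; _∩_; ∁; inside; outside; ⊤; ⊥)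
open import Data.Fin.Subset.Properties
  using (_⊆?_; ⊆⊤; ∩-identityˡ; ∣∁p∣≡n∸∣p∣; ∣⊥∣≡0; ∣p∩q∣≤∣q∣)
open import Data.List using (List; []; _∷_; _++_; map; allFin; filter; length)
open import Data.List.Membership.Propositional using (_∈_)
open import Data.List.Relation.Unary.Any using (here; there)
open import Data.List.Relation.Unary.All as All using (All; []; _∷_)
open import Data.Nat
  using (ℕ; zero; suc; _+_; _*_; _∸_; _%_; _≡ᵇ_; _≤_; s≤s; NonZero; >-nonZero)
open import Data.Nat.Properties
open import Data.Nat.Combinatorics using (_C_; nCk+nC[k+1]≡[n+1]C[k+1])
open import Data.Nat.Divisibility using (_∣_; _∣?_; ∣m∣n⇒∣m+n; _∣0)
open import Data.Product using (_×_; _,_; Σ-syntax)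
open import Data.Unit using (tt)
open import Data.Vec using (Vec; []; _∷_; lookup)
open import Function using (_∘_)
open import Function.Bundles using (Equivalence)
open import Relation.Nullary using (¬_; does)
open import Relation.Nullary.Decidable
  using (True; False; toWitness; toWitnessFalse; from-yes; dec-true; _→-dec_)
open import Relation.Unary using (Decidable)
open import Relation.Binary.PropositionalEquality
open ≡-Reasoning

private variable
  A A′ : Set

∑ : List A → (A → ℕ) → ℕ
∑ []       f = 0
∑ (x ∷ xs) f = f x + ∑ xs f

infix 5 ∑
syntax ∑ xs (λ x → e) = ∑[ x ∈ xs ] e

∑-++ : ∀ xs ys (f : A → ℕ) → ∑ (xs ++ ys) f ≡ ∑ xs f + ∑ ys f
∑-++ []       ys f = refl
∑-++ (x ∷ xs) ys f = trans (cong (f x +_) (∑-++ xs ys f)) (sym (+-assoc (f x) _ _))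

∑-map : ∀ (g : A′ → A) xs (f : A → ℕ) → ∑ (map g xs) f ≡ ∑ xs (f ∘ g)
∑-map g []       f = refl
∑-map g (x ∷ xs) f = cong (f (g x) +_) (∑-map g xs f)

∑-cong : ∀ xs {f g : A → ℕ} → (∀ {x} → x ∈ xs → f x ≡ g x) → ∑ xs f ≡ ∑ xs g
∑-cong []       eq = refl
∑-cong (x ∷ xs) eq = cong₂ _+_ (eq (here refl)) (∑-cong xs (eq ∘ there))

∑-zero : ∀ xs {f : A → ℕ} → (∀ x → f x ≡ 0) → ∑ xs f ≡ 0
∑-zero []       eq = refl
∑-zero (x ∷ xs) eq = cong₂ _+_ (eq x) (∑-zero xs eq)

∑-distrib-+ : ∀ xs (f g : A → ℕ) → ∑[ x ∈ xs ] (f x + g x) ≡ ∑ xs f + ∑ xs g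
∑-distrib-+ []       f g = refl
∑-distrib-+ (x ∷ xs) f g = begin
  f x + g x + (∑[ x ∈ xs ] (f x + g x)) ≡⟨ cong (f x + g x +_) (∑-distrib-+ xs f g) ⟩
  f x + g x + (∑ xs f + ∑ xs g)         ≡⟨ interchange +-commutativeSemigroup (f x) (g x) _ _ ⟩
  f x + ∑ xs f + (g x + ∑ xs g)         ∎

∑-distribˡ-* : ∀ xs c (f : A → ℕ) → ∑[ x ∈ xs ] (c * f x) ≡ c * ∑ xs f
∑-distribˡ-* []       c f = sym (*-zeroʳ c)
∑-distribˡ-* (x ∷ xs) c f =
  trans (cong (c * f x +_) (∑-distribˡ-* xs c f)) (sym (*-distribˡ-+ c (f x) _))

∑-distribʳ-* : ∀ xs c (f : A → ℕ) → ∑[ x ∈ xs ] (f x * c) ≡ ∑ xs f * c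
∑-distribʳ-* xs c f = begin
  ∑[ x ∈ xs ] (f x * c) ≡⟨ ∑-cong xs (λ {x} _ → *-comm (f x) c) ⟩
  ∑[ x ∈ xs ] (c * f x) ≡⟨ ∑-distribˡ-* xs c f ⟩
  c * ∑ xs f            ≡⟨ *-comm c _ ⟩
  ∑ xs f * c            ∎

∑-comm : ∀ xs (ys : List A′) (f : A → A′ → ℕ) →
         ∑[ x ∈ xs ] ∑[ y ∈ ys ] f x y ≡ ∑[ y ∈ ys ] ∑[ x ∈ xs ] f x y
∑-comm []       ys f = sym (∑-zero ys (λ _ → refl))
∑-comm (x ∷ xs) ys f = begin
  ∑ ys (f x) + (∑[ x ∈ xs ] ∑[ y ∈ ys ] f x y) ≡⟨ cong (∑ ys (f x) +_) (∑-comm xs ys f) ⟩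
  ∑ ys (f x) + (∑[ y ∈ ys ] ∑[ x ∈ xs ] f x y) ≡⟨ ∑-distrib-+ ys (f x) _ ⟨
  ∑[ y ∈ ys ] ∑[ x ∈ x ∷ xs ] f x y            ∎

∣-∑ : ∀ {d} xs {f : A → ℕ} → (∀ {x} → x ∈ xs → d ∣ f x) → d ∣ ∑ xs f
∣-∑ []       div = _ ∣0
∣-∑ (x ∷ xs) div = ∣m∣n⇒∣m+n (div (here refl)) (∣-∑ xs (div ∘ there))

𝟙 : Bool → ℕ
𝟙 true  = 1
𝟙 false = 0

length-filter≡∑𝟙 : ∀ {P : A → Set} (P? : Decidable P) xs →
                   length (filter P? xs) ≡ ∑[ x ∈ xs ] 𝟙 (does (P? x))
length-filter≡∑𝟙 P? []       = refl
length-filter≡∑𝟙 P? (x ∷ xs) with does (P? x)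
... | true  = cong suc (length-filter≡∑𝟙 P? xs)
... | false = length-filter≡∑𝟙 P? xs

subsets : ∀ n → List (Subset n)
subsets zero    = [] ∷ []
subsets (suc n) = map (inside ∷_) (subsets n) ++ map (outside ∷_) (subsets n)

∑-subsets-suc : ∀ {n} (f : Subset (suc n) → ℕ) →
  ∑ (subsets (suc n)) f ≡ (∑[ T ∈ subsets n ] f (inside ∷ T)) + (∑[ T ∈ subsets n ] f (outside ∷ T))
∑-subsets-suc {n} f = trans (∑-++ (map (inside ∷_) (subsets n)) (map (outside ∷_) (subsets n)) f)
  (cong₂ _+_ (∑-map (inside ∷_) (subsets n) f) (∑-map (outside ∷_) (subsets n) f))

∃-subset-of-size : ∀ {n t} → t ≤ n → Σ[ T ∈ Subset n ] ∣ T ∣ ≡ t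
∃-subset-of-size {n} {zero}  _         = ⊥ , ∣⊥∣≡0 n
∃-subset-of-size {t = suc t} (s≤s t≤n) with T , ∣T∣≡t ← ∃-subset-of-size t≤n =
  inside ∷ T , cong suc ∣T∣≡t

∣p∣≡∣p∩q∣+∣p∩∁q∣ : ∀ {n} (p q : Subset n) → ∣ p ∣ ≡ ∣ p ∩ q ∣ + ∣ p ∩ ∁ q ∣
∣p∣≡∣p∩q∣+∣p∩∁q∣ []            []           = refl
∣p∣≡∣p∩q∣+∣p∩∁q∣ (outside ∷ p) (_ ∷ q)      = ∣p∣≡∣p∩q∣+∣p∩∁q∣ p q
∣p∣≡∣p∩q∣+∣p∩∁q∣ (inside ∷ p)  (inside ∷ q)  = cong suc (∣p∣≡∣p∩q∣+∣p∩∁q∣ p q)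
∣p∣≡∣p∩q∣+∣p∩∁q∣ (inside ∷ p)  (outside ∷ q) =
  trans (cong suc (∣p∣≡∣p∩q∣+∣p∩∁q∣ p q)) (sym (+-suc _ _))

meets : ∀ {n} → Subset n → ℕ → ℕ → Subset n → Bool
meets B s u T = (∣ T ∩ B ∣ ≡ᵇ s) ∧ (∣ T ∩ ∁ B ∣ ≡ᵇ u)

meets⇒∣T∣≡s+u : ∀ {n} (B T : Subset n) {s u} → meets B s u T ≡ true → ∣ T ∣ ≡ s + u
meets⇒∣T∣≡s+u B T {s} {u} eq
  with ∣T∩B∣≡s , ∣T∩∁B∣≡u ← Equivalence.to (T-∧ {∣ T ∩ B ∣ ≡ᵇ s}) (Equivalence.from T-≡ eq) =
  trans (∣p∣≡∣p∩q∣+∣p∩∁q∣ T B)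
        (cong₂ _+_ (≡ᵇ⇒≡ ∣ T ∩ B ∣ s ∣T∩B∣≡s) (≡ᵇ⇒≡ ∣ T ∩ ∁ B ∣ u ∣T∩∁B∣≡u))

𝟙⊆meets : ∀ {n} → Subset n → Subset n → ℕ → ℕ → Subset n → ℕ
𝟙⊆meets X B s u T = 𝟙 (does (T ⊆? X)) * 𝟙 (meets B s u T)

∑-𝟙⊆meets : ∀ {n} (X B : Subset n) s u →
  ∑ (subsets n) (𝟙⊆meets X B s u) ≡ (∣ X ∩ B ∣ C s) * (∣ X ∩ ∁ B ∣ C u)
∑-𝟙⊆meets []            []            zero    zero    = refl
∑-𝟙⊆meets []            []            zero    (suc u) = refl
∑-𝟙⊆meets []            []            (suc s) zero    = refl
∑-𝟙⊆meets []            []            (suc s) (suc u) = refl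
∑-𝟙⊆meets {suc n} (outside ∷ X) (b ∷ B)       s       u =
  trans (∑-subsets-suc (𝟙⊆meets (outside ∷ X) (b ∷ B) s u))
    (cong₂ _+_ (∑-zero (subsets n) (λ _ → refl)) (∑-𝟙⊆meets X B s u))
∑-𝟙⊆meets {suc n} (inside ∷ X)  (inside ∷ B)  zero    u =
  trans (∑-subsets-suc (𝟙⊆meets (inside ∷ X) (inside ∷ B) zero u))
    (cong₂ _+_ (∑-zero (subsets n) (λ T → *-zeroʳ (𝟙 (does (T ⊆? X)))))
               (∑-𝟙⊆meets X B zero u))
∑-𝟙⊆meets (inside ∷ X)  (inside ∷ B)  (suc s) u       =
  trans (∑-subsets-suc (𝟙⊆meets (inside ∷ X) (inside ∷ B) (suc s) u))
    (trans (cong₂ _+_ (∑-𝟙⊆meets X B s u) (∑-𝟙⊆meets X B (suc s) u))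
      (trans (sym (*-distribʳ-+ (∣ X ∩ ∁ B ∣ C u) (∣ X ∩ B ∣ C s) _))
        (cong (_* (∣ X ∩ ∁ B ∣ C u)) (nCk+nC[k+1]≡[n+1]C[k+1] ∣ X ∩ B ∣ s))))
∑-𝟙⊆meets {suc n} (inside ∷ X)  (outside ∷ B) s       zero =
  trans (∑-subsets-suc (𝟙⊆meets (inside ∷ X) (outside ∷ B) s zero))
    (cong₂ _+_ (∑-zero (subsets n) (λ T → trans (cong (λ b → 𝟙 (does (T ⊆? X)) * 𝟙 b) (∧-zeroʳ _))
                                                 (*-zeroʳ (𝟙 (does (T ⊆? X))))))
               (∑-𝟙⊆meets X B s zero))
∑-𝟙⊆meets (inside ∷ X)  (outside ∷ B) s       (suc u) =
  trans (∑-subsets-suc (𝟙⊆meets (inside ∷ X) (outside ∷ B) s (suc u)))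
    (trans (cong₂ _+_ (∑-𝟙⊆meets X B s u) (∑-𝟙⊆meets X B s (suc u)))
      (trans (sym (*-distribˡ-+ (∣ X ∩ B ∣ C s) (∣ X ∩ ∁ B ∣ C u) _))
        (cong ((∣ X ∩ B ∣ C s) *_) (nCk+nC[k+1]≡[n+1]C[k+1] ∣ X ∩ ∁ B ∣ u))))

meetCount : (t n i s : ℕ) → ℕ
meetCount t n i s = (i C s) * ((n ∸ i) C (t ∸ s))

∑-meetCount : ∀ {t v k λ′} {ℬ : List (Subset v)} → IsDesign t v k λ′ ℬ →
  ∀ B → ∣ B ∣ ≡ k → ∀ {s} → s ≤ t →
  ∑[ B′ ∈ ℬ ] meetCount t k ∣ B′ ∩ B ∣ s ≡ λ′ * meetCount t v k s
∑-meetCount {t} {v} {k} {λ′} {ℬ} (block-size , through) B ∣B∣≡k {s} s≤t = begin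
  ∑[ B′ ∈ ℬ ] meetCount t k ∣ B′ ∩ B ∣ s
    ≡⟨ ∑-cong ℬ count-in-block ⟩
  ∑[ B′ ∈ ℬ ] ∑[ T ∈ subsets v ] 𝟙 (does (T ⊆? B′)) * 𝟙 (meets B s u T)
    ≡⟨ ∑-comm ℬ (subsets v) _ ⟩
  ∑[ T ∈ subsets v ] ∑[ B′ ∈ ℬ ] 𝟙 (does (T ⊆? B′)) * 𝟙 (meets B s u T)
    ≡⟨ ∑-cong (subsets v) (λ {T} _ → trans (∑-distribʳ-* ℬ _ _) (blocks-through T)) ⟩
  ∑[ T ∈ subsets v ] λ′ * 𝟙 (meets B s u T)
    ≡⟨ ∑-distribˡ-* (subsets v) λ′ _ ⟩
  λ′ * (∑[ T ∈ subsets v ] 𝟙 (meets B s u T))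
    ≡⟨ cong (λ′ *_) (∑-cong (subsets v) (λ {T} _ → sym (within-⊤ T))) ⟩
  λ′ * (∑[ T ∈ subsets v ] 𝟙 (does (T ⊆? ⊤)) * 𝟙 (meets B s u T))
    ≡⟨ cong (λ′ *_) (∑-𝟙⊆meets ⊤ B s u) ⟩
  λ′ * ((∣ ⊤ ∩ B ∣ C s) * (∣ ⊤ ∩ ∁ B ∣ C u))
    ≡⟨ cong₂ (λ p q → λ′ * ((∣ p ∣ C s) * (∣ q ∣ C u))) (∩-identityˡ B) (∩-identityˡ (∁ B)) ⟩
  λ′ * ((∣ B ∣ C s) * (∣ ∁ B ∣ C u))
    ≡⟨ cong (λ c → λ′ * ((∣ B ∣ C s) * (c C u))) (∣∁p∣≡n∸∣p∣ B) ⟩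
  λ′ * ((∣ B ∣ C s) * ((v ∸ ∣ B ∣) C u))
    ≡⟨ cong (λ c → λ′ * meetCount t v c s) ∣B∣≡k ⟩
  λ′ * meetCount t v k s
    ∎
  where
  u = t ∸ s

  count-in-block : ∀ {B′} → B′ ∈ ℬ →
    meetCount t k ∣ B′ ∩ B ∣ s ≡ ∑[ T ∈ subsets v ] 𝟙 (does (T ⊆? B′)) * 𝟙 (meets B s u T)
  count-in-block {B′} B′∈ℬ = begin
    (∣ B′ ∩ B ∣ C s) * ((k ∸ ∣ B′ ∩ B ∣) C u)
      ≡⟨ cong (λ c → (∣ B′ ∩ B ∣ C s) * ((c ∸ ∣ B′ ∩ B ∣) C u))
              (trans (sym (block-size B′ B′∈ℬ)) (∣p∣≡∣p∩q∣+∣p∩∁q∣ B′ B)) ⟩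
    (∣ B′ ∩ B ∣ C s) * ((∣ B′ ∩ B ∣ + ∣ B′ ∩ ∁ B ∣ ∸ ∣ B′ ∩ B ∣) C u)
      ≡⟨ cong (λ c → (∣ B′ ∩ B ∣ C s) * (c C u)) (m+n∸m≡n ∣ B′ ∩ B ∣ _) ⟩
    (∣ B′ ∩ B ∣ C s) * (∣ B′ ∩ ∁ B ∣ C u)
      ≡⟨ ∑-𝟙⊆meets B′ B s u ⟨
    ∑[ T ∈ subsets v ] 𝟙 (does (T ⊆? B′)) * 𝟙 (meets B s u T)
      ∎

  blocks-through : ∀ T →
    (∑[ B′ ∈ ℬ ] 𝟙 (does (T ⊆? B′))) * 𝟙 (meets B s u T) ≡ λ′ * 𝟙 (meets B s u T)
  blocks-through T with meets B s u T in eq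
  ... | false = trans (*-zeroʳ (∑[ B′ ∈ ℬ ] 𝟙 (does (T ⊆? B′)))) (sym (*-zeroʳ λ′))
  ... | true  = cong (_* 1) (trans (sym (length-filter≡∑𝟙 (T ⊆?_) ℬ))
                                   (through T (trans (meets⇒∣T∣≡s+u B T eq) (m+[n∸m]≡n s≤t))))

  within-⊤ : ∀ T → 𝟙 (does (T ⊆? ⊤)) * 𝟙 (meets B s u T) ≡ 𝟙 (meets B s u T)
  within-⊤ T = trans (cong (λ b → 𝟙 b * 𝟙 (meets B s u T)) (dec-true (T ⊆? ⊤) (⊆⊤ {p = T})))
                     (*-identityˡ _)

weightedSum : ∀ {t} → Vec ℕ (suc t) → (ℕ → ℕ) → ℕ
weightedSum {t} c f = ∑[ s ∈ allFin (suc t) ] lookup c s * f (toℕ s)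

∑-weightedSum-meetCount : ∀ {t v k λ′} {ℬ : List (Subset v)} → IsDesign t v k λ′ ℬ →
  ∀ B → ∣ B ∣ ≡ k → (c : Vec ℕ (suc t)) →
  ∑[ B′ ∈ ℬ ] weightedSum c (meetCount t k ∣ B′ ∩ B ∣) ≡ λ′ * weightedSum c (meetCount t v k)
∑-weightedSum-meetCount {t} {v} {k} {λ′} {ℬ} design B ∣B∣≡k c = begin
  ∑[ B′ ∈ ℬ ] weightedSum c (meetCount t k ∣ B′ ∩ B ∣)
    ≡⟨ ∑-comm ℬ S _ ⟩
  ∑[ s ∈ S ] ∑[ B′ ∈ ℬ ] lookup c s * meetCount t k ∣ B′ ∩ B ∣ (toℕ s)
    ≡⟨ ∑-cong S (λ {s} _ → ∑-distribˡ-* ℬ (lookup c s) (λ B′ → meetCount t k ∣ B′ ∩ B ∣ (toℕ s))) ⟩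
  ∑[ s ∈ S ] lookup c s * (∑[ B′ ∈ ℬ ] meetCount t k ∣ B′ ∩ B ∣ (toℕ s))
    ≡⟨ ∑-cong S (λ {s} _ → cong (lookup c s *_) (∑-meetCount design B ∣B∣≡k (≤-pred (toℕ<n s)))) ⟩
  ∑[ s ∈ S ] lookup c s * (λ′ * meetCount t v k (toℕ s))
    ≡⟨ ∑-cong S (λ {s} _ → x∙yz≈y∙xz *-commutativeSemigroup (lookup c s) λ′ _) ⟩
  ∑[ s ∈ S ] λ′ * (lookup c s * meetCount t v k (toℕ s))
    ≡⟨ ∑-distribˡ-* S λ′ _ ⟩
  λ′ * weightedSum c (meetCount t v k)
    ∎
  where
  S = allFin (suc t)

self-orthogonal-divisibility : ∀ {t v k λ′ N} {ℬ : List (Subset v)} → t ≤ v →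
  IsDesign t v k λ′ ℬ → SelfOrthogonal k ℬ → (c : Vec ℕ (suc t)) →
  (∀ {i} → i ≤ k → i % 2 ≡ k % 2 → N ∣ weightedSum c (meetCount t k i)) →
  N ∣ λ′ * weightedSum c (meetCount t v k)
self-orthogonal-divisibility {v = v} {N = N} {ℬ = []} t≤v (_ , through) _ c _
  with T , ∣T∣≡t ← ∃-subset-of-size t≤v =
  subst (λ l → N ∣ l * weightedSum c (meetCount _ v _)) (through T ∣T∣≡t) (_ ∣0)
self-orthogonal-divisibility {k = k} {N = N} {ℬ = B ∷ ℬ₀} _ design@(block-size , _) so c vanishes =
  subst (N ∣_) (∑-weightedSum-meetCount design B ∣B∣≡k c) (∣-∑ (B ∷ ℬ₀) vanishes-at)
  where
  ∣B∣≡k = block-size B (here refl)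

  vanishes-at : ∀ {B′} → B′ ∈ B ∷ ℬ₀ → N ∣ weightedSum c (meetCount _ k ∣ B′ ∩ B ∣)
  vanishes-at {B′} B′∈ℬ = vanishes (subst (∣ B′ ∩ B ∣ ≤_) ∣B∣≡k (∣p∩q∣≤∣q∣ B′ B))
                                   (so B′ B B′∈ℬ (here refl))

≤24*m : ∀ {n m} .{{_ : NonZero m}} → n ≤ 24 → n ≤ 24 * m
≤24*m {m = m} n≤24 = ≤-trans n≤24 (m≤m*n 24 m)

IsLambda7-unique : ∀ {m} .{{_ : NonZero m}} a b → IsLambda7 m a → IsLambda7 m b → a ≡ b
IsLambda7-unique {m} a b p q =
  *-cancelʳ-≡ _ _ ((24 * m ∸ 5) * (24 * m ∸ 6)) {{denominator≢0}} (trans p (sym q))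
  where
  denominator≢0 : NonZero ((24 * m ∸ 5) * (24 * m ∸ 6))
  denominator≢0 = m*n≢0 _ _
    {{>-nonZero (m<n⇒0<n∸m (≤24*m (≤ᵇ⇒≤ 6 24 tt)))}}
    {{>-nonZero (m<n⇒0<n∸m (≤24*m (≤ᵇ⇒≤ 7 24 tt)))}}

record Certificate (m : ℕ) : Set where
  constructor certificate
  field
    λ₇ modulus   : ℕ
    coefficients : Vec ℕ 8
    isLambda7    : IsLambda7 m λ₇
    vanishes     : True (allUpTo?
      (λ i → (i % 2 ≟ (4 * m + 4) % 2) →-dec
             (modulus ∣? weightedSum coefficients (meetCount 7 (4 * m + 4) i)))
      (suc (4 * m + 4)))
    nondividing  : False (modulus ∣? λ₇ * weightedSum coefficients (meetCount 7 (24 * m) (4 * m + 4)))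

certificate-refutes : ∀ {m} .{{_ : NonZero m}} → Certificate m → ∀ {λ₇} → IsLambda7 m λ₇ →
  (ℬ : List (Subset (24 * m))) →
  ¬ (IsDesign 7 (24 * m) (4 * m + 4) λ₇ ℬ × SelfOrthogonal (4 * m + 4) ℬ)
certificate-refutes {m} cert {λ₇′} isλ ℬ (design , so) =
  toWitnessFalse nondividing
    (subst (λ l → modulus ∣ l * weightedSum coefficients (meetCount 7 (24 * m) (4 * m + 4)))
           (IsLambda7-unique λ₇′ λ₇ isλ isLambda7)
      (self-orthogonal-divisibility (≤24*m (≤ᵇ⇒≤ 7 24 tt)) design so coefficients
        (λ i≤k → toWitness vanishes (s≤s i≤k))))
  where open Certificate cert

exceptionalMs-nonZero : All NonZero exceptionalMs
exceptionalMs-nonZero = from-yes (All.all? nonZero? exceptionalMs)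

certificates : All Certificate exceptionalMs
certificates =
  certificate {8} 337440
    129515520 (0 ∷ 129515403 ∷ 1131 ∷ 129508554 ∷ 38118 ∷ 129308945 ∷ 1168497 ∷ 122386944 ∷ [])
    refl tt tt ∷
  certificate {40} 9090477539288121907521579654436691688768
    34719391825920 (0 ∷ 34719391823775 ∷ 112255 ∷ 34719387812130 ∷ 128618958 ∷ 34715325459085 ∷ 133247555565 ∷ 30046012715520 ∷ [])
    refl tt tt ∷
  certificate {42} 1322229756807160369322262861177824340133920
    3099158147072 (0 ∷ 143 ∷ 3099158139207 ∷ 338382 ∷ 3099145137394 ∷ 481725385 ∷ 3081101343745 ∷ 710444851200 ∷ [])
    refl tt tt ∷
  certificate {50} 597901388219883081918088983461520379954911932641080
    395897174323200 (0 ∷ 6435 ∷ 395897174049115 ∷ 9579822 ∷ 395896846945842 ∷ 11609065965 ∷ 395456444013285 ∷ 18309924864000 ∷ [])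
    refl tt tt ∷
  certificate {74} 58972932242080642847921211326800594742312241646500607261535735728298175954960
    67567271546880 (0 ∷ 105 ∷ 67567271536625 ∷ 784546 ∷ 67567217749150 ∷ 3557464575 ∷ 67329095438855 ∷ 16731575705600 ∷ [])
    refl tt tt ∷
  certificate {76} 8671813230480757482403469882987484739701736361971023628677592627066703168059440
    2267149985488896 (0 ∷ 2267149985485893 ∷ 301301 ∷ 2267149964701206 ∷ 1286519994 ∷ 2267071461594111 ∷ 4963529802735 ∷ 1931635163521536 ∷ [])
    refl tt tt ∷
  certificate {80} 187699774413667006170995019869160978505961842251891940561974451389567903488400574080
    6605746186321920 (0 ∷ 6605746186315485 ∷ 679965 ∷ 6605746136898150 ∷ 3222641514 ∷ 6605538955914215 ∷ 13800007090215 ∷ 5623057377431040 ∷ [])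
    refl tt tt ∷
  certificate {86} 599085049965063162863512968998051550361972088474721393967837478159974747182000668174805600
    10188119076065280 (0 ∷ 6435 ∷ 10188119075333835 ∷ 65141142 ∷ 10188113873420778 ∷ 400796764245 ∷ 10156856927575805 ∷ 2558377650483200 ∷ [])
    refl tt tt ∷
  certificate {100} 906580655706417687499504192052624122834460605173600881648716247016419095291514138824491002233779138642960
    644937305497600 (0 ∷ 165 ∷ 644937305475765 ∷ 2264394 ∷ 644937094807318 ∷ 18912733475 ∷ 643218326961075 ∷ 163912573440000 ∷ [])
    refl tt tt ∷
  certificate {130} 315440543150065648584343635548514608142569480370712375967119758609785729206586791550177955361645471211965521172297545185691222768604100280
    282798978627809280 (0 ∷ 282798978627794265 ∷ 2587585 ∷ 282798978320295150 ∷ 32796204066 ∷ 282795529751518635 ∷ 375471028752435 ∷ 239104153484636160 ∷ [])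
    refl tt tt ∷
  certificate {144} 488998268043647702191248101345916588914565668109004048263110883040131628840674697887756630703490624634359713862158132472775606093767627123107691252041920
    174032613153996800 (0 ∷ 5005 ∷ 174032613153040845 ∷ 143141306 ∷ 174032593907387110 ∷ 2497589604475 ∷ 173704429780876475 ∷ 45236631004364800 ∷ [])
    refl tt tt ∷
  certificate {150} 1585349526263967863085763637655189116073079815769197669544202805034862111213035381286974569547612952006150802734696274401595430054510447517803642044067006810800
    31755261806694400 (0 ∷ 715 ∷ 31755261806552115 ∷ 22198374 ∷ 31755258696567578 ∷ 420559167725 ∷ 31697677146807125 ∷ 8271045404160000 ∷ [])
    refl tt tt ∷
  []

theorem4 : ∀ (m λ₇ : ℕ) → m ∈ exceptionalMs → IsLambda7 m λ₇ →
    (ℬ : List (Subset (24 * m))) →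
    ¬ (IsDesign 7 (24 * m) (4 * m + 4) λ₇ ℬ × SelfOrthogonal (4 * m + 4) ℬ)
theorem4 m λ₇ m∈exceptionalMs =
  certificate-refutes {{All.lookup exceptionalMs-nonZero m∈exceptionalMs}}
    (All.lookup certificates m∈exceptionalMs)
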